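{- Let $k\ge 1$ and $n\ge \max\{4,2k-1\}$ be integers. For any coloring $\phi$ of $E(K_n)$ using exactly $k$ colors, there is a vertex $v$ such that the restriction of $\phi$ to $E(K_n-v)$ uses exactly $k$ colors. -}

module Defs where

open import Data.Nat using (ℕ; _≤_; _⊔_; _∸_; _*_)
open import Data.Fin using (Fin)
open import Data.Product using (Σ; ∃; _×_; _,_)
open import Relation.Binary.PropositionalEquality using (_≡_; _≢_)

-- An edge-colouring of the complete graph K_n (vertex set Fin n) with
-- colour set C: a function on ordered pairs that is symmetric, so it is a
-- function on unordered pairs {i,j}; the value on the diagonal i = i is
-- irrelevant (never used), since K_n has no loops.
record EdgeColouring (n : ℕ) (C : Set) : Set where
  field
    col : Fin n → Fin n → C
    sym : ∀ i j → i ≢ j → col i j ≡ col j i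
open EdgeColouring public

Used : ∀ {n C} → EdgeColouring n C → C → Set
Used {n} φ c = Σ (Fin n) λ i → Σ (Fin n) λ j → i ≢ j × col φ i j ≡ c

UsesExactly : ∀ {n} (k : ℕ) → EdgeColouring n (Fin k) → Set
UsesExactly k φ = ∀ (c : Fin k) → Used φ c

UsedAvoiding : ∀ {n C} → EdgeColouring n C → Fin n → C → Set
UsedAvoiding {n} φ v c =
  Σ (Fin n) λ i → Σ (Fin n) λ j → i ≢ j × i ≢ v × j ≢ v × col φ i j ≡ c

UsesExactlyAvoiding : ∀ {n} (k : ℕ) → EdgeColouring n (Fin k) → Fin n → Set
UsesExactlyAvoiding k φ v = ∀ (c : Fin k) → UsedAvoiding φ v c

-- Suppose no vertex works. Then every vertex v has a colour f(v) all of whose edges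
-- touch v, and since an edge has only two ends, no three vertices share a value of f.
-- Counting the fibres of f against n ≥ 2k − 1 shows that f is onto and that at most one
-- vertex is alone in its fibre. Now take a fibre {u, p} of size two and a vertex
-- w ∉ {u, p}: the colour of uw is f(y) with y ∈ {u, w}; y = u forces uw to touch p,
-- so w must be alone. As n ≥ 4 there are two such w, which is impossible.
module Submission where

open import Defs hiding (sym)
open import Data.Nat using (ℕ; _≤_; _⊔_; _∸_; _*_; _+_; suc; s≤s)
open import Data.Nat.Properties using (m⊔n≤o⇒m≤o; m⊔n≤o⇒n≤o; *-comm; ≤-trans; ≤-reflexive; <-irrefl)
open import Data.Fin using (Fin; zero; suc; combine; _<_)
open import Data.Fin.Properties using (any?; all?; ¬∀⟶∃¬; _≟_; _<?_; combine-injective; injective⇒≤; <-cmp; <⇒≢; <-trans)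
open import Data.Vec.Functional using (_∷_)
open import Data.Product using (Σ; ∃; _×_; _,_; proj₁; proj₂)
open import Data.Sum using (_⊎_; inj₁; inj₂)
open import Data.Empty using (⊥; ⊥-elim)
open import Function.Definitions using (Injective)
open import Relation.Nullary using (¬_; Dec; yes; no; ¬?; _×-dec_)
open import Relation.Binary using (tri<; tri≈; tri>)
open import Relation.Binary.PropositionalEquality using (_≡_; _≢_; refl; sym; trans; ≢-sym)

∷-injective : ∀ {N M} {h : Fin N → Fin M} {p : Fin M} →
              Injective _≡_ _≡_ h → (∀ v → h v ≢ p) → Injective _≡_ _≡_ (p ∷ h)
∷-injective inj avoid {zero}  {zero}  _ = refl
∷-injective inj avoid {zero}  {suc y} e = ⊥-elim (avoid y (sym e))
∷-injective inj avoid {suc x} {zero}  e = ⊥-elim (avoid x e)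
∷-injective inj avoid {suc x} {suc y} e with refl ← inj e = refl

injective-avoiding-two⇒2+≤ : ∀ {N M} {h : Fin N → Fin M} {p q : Fin M} → p ≢ q →
                             Injective _≡_ _≡_ h → (∀ v → h v ≢ p) → (∀ v → h v ≢ q) →
                             2 + N ≤ M
injective-avoiding-two⇒2+≤ {h = h} {p} {q} p≢q inj avoid-p avoid-q =
  injective⇒≤ (∷-injective (∷-injective inj avoid-p) p∷h-avoids-q)
  where
  p∷h-avoids-q : ∀ v → (p ∷ h) v ≢ q
  p∷h-avoids-q zero    = p≢q
  p∷h-avoids-q (suc v) = avoid-q v

m∸1≤n⇒2+n≰m : ∀ m n → m ∸ 1 ≤ n → ¬ (2 + n ≤ m)
m∸1≤n⇒2+n≰m (suc m) n m≤n (s≤s 2+n≤m) = <-irrefl refl (≤-trans 2+n≤m m≤n)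

module FibresOfSizeAtMostTwo
  {n k : ℕ} (f : Fin n → Fin k)
  (no-triple : ∀ {a b c} → a ≢ b → b ≢ c → a ≢ c → f a ≡ f b → f b ≡ f c → ⊥)
  (2k∸1≤n : 2 * k ∸ 1 ≤ n)
  where

  Paired : Fin n → Set
  Paired v = ∃ λ u → u ≢ v × f u ≡ f v

  paired? : ∀ v → Dec (Paired v)
  paired? v = any? λ u → ¬? (u ≟ v) ×-dec (f u ≟ f v)

  Repeated : Fin n → Set
  Repeated v = ∃ λ u → u < v × f u ≡ f v

  repeated? : ∀ v → Dec (Repeated v)
  repeated? v = any? λ u → (u <? v) ×-dec (f u ≟ f v)

  tag : Fin n → Fin 2
  tag v with repeated? v
  ... | yes _ = suc zero
  ... | no  _ = zero

  tag≡1⇒repeated : ∀ {v} → tag v ≡ suc zero → Repeated v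
  tag≡1⇒repeated {v} tag≡1 with repeated? v
  ... | yes r = r

  repeated⇒tag≡1 : ∀ {v} → Repeated v → tag v ≡ suc zero
  repeated⇒tag≡1 {v} r with repeated? v
  ... | yes _  = refl
  ... | no ¬r = ⊥-elim (¬r r)

  -- The tag records whether an earlier point shares the fibre; as fibres have at most
  -- two points, it separates the points of each fibre.
  tagged : Fin n → Fin (k * 2)
  tagged v = combine (f v) (tag v)

  <-in-fibre⇒tag≢ : ∀ {u v} → u < v → f u ≡ f v → tag u ≢ tag v
  <-in-fibre⇒tag≢ {u} {v} u<v fu≡fv tagu≡tagv
    with w , w<u , fw≡fu ← tag≡1⇒repeated (trans tagu≡tagv (repeated⇒tag≡1 (u , u<v , fu≡fv)))
    = no-triple (<⇒≢ w<u) (<⇒≢ u<v) (<⇒≢ (<-trans w<u u<v)) fw≡fu fu≡fv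

  tagged-injective : Injective _≡_ _≡_ tagged
  tagged-injective {x} {y} e with combine-injective (f x) (tag x) (f y) (tag y) e | <-cmp x y
  ... | _           | tri≈ _ x≡y _ = x≡y
  ... | (e₁ , e₂) | tri< x<y _ _ = ⊥-elim (<-in-fibre⇒tag≢ x<y e₁ e₂)
  ... | (e₁ , e₂) | tri> _ _ y<x = ⊥-elim (<-in-fibre⇒tag≢ y<x (sym e₁) (sym e₂))

  tagged-cannot-avoid-two : ∀ {p q} → p ≢ q → (∀ v → tagged v ≢ p) → (∀ v → tagged v ≢ q) → ⊥
  tagged-cannot-avoid-two p≢q avoid-p avoid-q =
    m∸1≤n⇒2+n≰m (2 * k) n 2k∸1≤n
      (≤-trans (injective-avoiding-two⇒2+≤ p≢q tagged-injective avoid-p avoid-q)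
               (≤-reflexive (*-comm k 2)))

  surjective : ∀ c → ∃ λ v → f v ≡ c
  surjective c with any? (λ v → f v ≟ c)
  ... | yes hit = hit
  ... | no ¬hit = ⊥-elim (tagged-cannot-avoid-two {combine c zero} {combine c (suc zero)}
        (λ e → 0≢1 (proj₂ (combine-injective c zero c (suc zero) e)))
        (λ v e → ¬hit (v , proj₁ (combine-injective (f v) (tag v) c zero e)))
        (λ v e → ¬hit (v , proj₁ (combine-injective (f v) (tag v) c (suc zero) e))))
    where
    0≢1 : zero ≢ suc {1} zero
    0≢1 ()

  unpaired-fibre : ∀ {s u} → ¬ Paired s → f u ≡ f s → u ≡ s
  unpaired-fibre {s} {u} ¬paired fu≡fs with u ≟ s
  ... | yes u≡s = u≡s
  ... | no  u≢s = ⊥-elim (¬paired (u , u≢s , fu≡fs))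

  tagged-avoids-unpaired : ∀ {s} → ¬ Paired s → ∀ v → tagged v ≢ combine (f s) (suc zero)
  tagged-avoids-unpaired {s} ¬paired v e
    with fv≡fs , tagv≡1 ← combine-injective (f v) (tag v) (f s) (suc zero) e
    with refl ← unpaired-fibre ¬paired fv≡fs
    with w , w<v , fw≡fv ← tag≡1⇒repeated tagv≡1
    = <⇒≢ w<v (unpaired-fibre ¬paired fw≡fv)

  unpaired-unique : ∀ {s t} → ¬ Paired s → ¬ Paired t → s ≢ t → ⊥
  unpaired-unique {s} {t} ¬paired-s ¬paired-t s≢t =
    tagged-cannot-avoid-two
      (λ e → s≢t (sym (unpaired-fibre ¬paired-s (sym (proj₁ (combine-injective (f s) _ (f t) _ e))))))
      (tagged-avoids-unpaired ¬paired-s)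
      (tagged-avoids-unpaired ¬paired-t)

Covers : ∀ {n k} → EdgeColouring n (Fin k) → Fin n → Fin k → Set
Covers {n} φ v c = ∀ (i j : Fin n) → i ≢ j → col φ i j ≡ c → i ≡ v ⊎ j ≡ v

usedAvoiding? : ∀ {n k} (φ : EdgeColouring n (Fin k)) v c → Dec (UsedAvoiding φ v c)
usedAvoiding? φ v c =
  any? λ i → any? λ j → ¬? (i ≟ j) ×-dec ¬? (i ≟ v) ×-dec ¬? (j ≟ v) ×-dec (col φ i j ≟ c)

¬usedAvoiding⇒covers : ∀ {n k} (φ : EdgeColouring n (Fin k)) {v c} →
                       ¬ UsedAvoiding φ v c → Covers φ v c
¬usedAvoiding⇒covers φ {v} ¬used i j i≢j e with i ≟ v | j ≟ v
... | yes i≡v | _       = inj₁ i≡v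
... | no  _   | yes j≡v = inj₂ j≡v
... | no  i≢v | no  j≢v = ⊥-elim (¬used (i , j , i≢j , i≢v , j≢v , e))

module CoveringColours
  {n k : ℕ} (φ : EdgeColouring n (Fin k)) (uses : UsesExactly k φ)
  (f : Fin n → Fin k) (covers : ∀ v → Covers φ v (f v))
  where

  no-triple : ∀ {a b c} → a ≢ b → b ≢ c → a ≢ c → f a ≡ f b → f b ≡ f c → ⊥
  no-triple {a} {b} {c} a≢b b≢c a≢c fa≡fb fb≡fc
    with i , j , i≢j , e ← uses (f a)
    with covers a i j i≢j e
       | covers b i j i≢j (trans e fa≡fb)
       | covers c i j i≢j (trans e (trans fa≡fb fb≡fc))
  ... | inj₁ refl | inj₁ refl | _         = a≢b refl
  ... | inj₂ refl | inj₂ refl | _         = a≢b refl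
  ... | inj₁ refl | inj₂ refl | inj₁ refl = a≢c refl
  ... | inj₁ refl | inj₂ refl | inj₂ refl = b≢c refl
  ... | inj₂ refl | inj₁ refl | inj₁ refl = b≢c refl
  ... | inj₂ refl | inj₁ refl | inj₂ refl = a≢c refl

  module _ (2k∸1≤n : 2 * k ∸ 1 ≤ n) where

    open FibresOfSizeAtMostTwo f no-triple 2k∸1≤n

    colour-at-endpoint : ∀ {u w} → u ≢ w → col φ u w ≡ f u ⊎ col φ u w ≡ f w
    colour-at-endpoint {u} {w} u≢w
      with y , fy≡c ← surjective (col φ u w)
      with covers y u w u≢w (sym fy≡c)
    ... | inj₁ refl = inj₁ (sym fy≡c)
    ... | inj₂ refl = inj₂ (sym fy≡c)

    outside-pair-unpaired : ∀ {u p w} → p ≢ u → f p ≡ f u → w ≢ u → w ≢ p → ¬ Paired w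
    outside-pair-unpaired {u} {p} {w} p≢u fp≡fu w≢u w≢p (q , q≢w , fq≡fw)
      with colour-at-endpoint (≢-sym w≢u)
    ... | inj₁ c≡fu with covers p u w (≢-sym w≢u) (trans c≡fu (sym fp≡fu))
    ...   | inj₁ u≡p = p≢u (sym u≡p)
    ...   | inj₂ w≡p = w≢p w≡p
    outside-pair-unpaired {u} {p} {w} p≢u fp≡fu w≢u w≢p (q , q≢w , fq≡fw)
      | inj₂ c≡fw with covers q u w (≢-sym w≢u) (trans c≡fw (sym fq≡fw))
    ...   | inj₂ w≡q = q≢w (sym w≡q)
    ...   | inj₁ refl = no-triple p≢u (≢-sym w≢u) (≢-sym w≢p) fp≡fu fq≡fw

    unpaired-unless-p : ∀ {p b c d} → (b ≢ p → ¬ Paired b) → (c ≢ p → ¬ Paired c) →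
                        (d ≢ p → ¬ Paired d) → b ≢ c → b ≢ d → c ≢ d → ⊥
    unpaired-unless-p {p} {b} {c} unpaired-b unpaired-c unpaired-d b≢c b≢d c≢d with b ≟ p | c ≟ p
    ... | yes refl | _        = unpaired-unique (unpaired-c (≢-sym b≢c)) (unpaired-d (≢-sym b≢d)) c≢d
    ... | no b≢p   | yes refl = unpaired-unique (unpaired-b b≢p) (unpaired-d (≢-sym c≢d)) b≢d
    ... | no b≢p   | no c≢p   = unpaired-unique (unpaired-b b≢p) (unpaired-c c≢p) b≢c

    paired-beside-three : ∀ {a b c d} → Paired a → b ≢ a → c ≢ a → d ≢ a →
                          b ≢ c → b ≢ d → c ≢ d → ⊥
    paired-beside-three (p , p≢a , fp≡fa) b≢a c≢a d≢a =
      unpaired-unless-p (outside-pair-unpaired p≢a fp≡fa b≢a)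
                        (outside-pair-unpaired p≢a fp≡fa c≢a)
                        (outside-pair-unpaired p≢a fp≡fa d≢a)

    four-distinct⇒⊥ : ∀ {a b c d} → a ≢ b → a ≢ c → a ≢ d → b ≢ c → b ≢ d → c ≢ d → ⊥
    four-distinct⇒⊥ {a} {b} a≢b a≢c a≢d b≢c b≢d c≢d with paired? a | paired? b
    ... | yes paired-a | _          = paired-beside-three paired-a (≢-sym a≢b) (≢-sym a≢c) (≢-sym a≢d) b≢c b≢d c≢d
    ... | no _         | yes paired-b = paired-beside-three paired-b a≢b (≢-sym b≢c) (≢-sym b≢d) a≢c a≢d c≢d
    ... | no ¬paired-a | no ¬paired-b = unpaired-unique ¬paired-a ¬paired-b a≢b

covering-colours-impossible : ∀ {n k} → 4 ≤ n → 2 * k ∸ 1 ≤ n →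
                              (φ : EdgeColouring n (Fin k)) → UsesExactly k φ →
                              (f : Fin n → Fin k) → (∀ v → Covers φ v (f v)) → ⊥
covering-colours-impossible (s≤s (s≤s (s≤s (s≤s _)))) 2k∸1≤n φ uses f covers =
  CoveringColours.four-distinct⇒⊥ φ uses f covers 2k∸1≤n
    {zero} {suc zero} {suc (suc zero)} {suc (suc (suc zero))}
    (λ ()) (λ ()) (λ ()) (λ ()) (λ ()) (λ ())

¬usesExactlyAvoiding⇒covers : ∀ {n k} (φ : EdgeColouring n (Fin k)) {v} →
                              ¬ UsesExactlyAvoiding k φ v → ∃ (Covers φ v)
¬usesExactlyAvoiding⇒covers {k = k} φ {v} ¬uses
  with c , ¬used ← ¬∀⟶∃¬ k _ (usedAvoiding? φ v) ¬uses
  = c , ¬usedAvoiding⇒covers φ ¬used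

fact2p4 : (k n : ℕ) → 1 ≤ k → 4 ⊔ (2 * k ∸ 1) ≤ n →
    (φ : EdgeColouring n (Fin k)) → UsesExactly k φ →
    Σ (Fin n) λ v → UsesExactlyAvoiding k φ v
fact2p4 k n _ bounds φ uses with any? (λ v → all? (usedAvoiding? φ v))
... | yes good = good
... | no ¬good = ⊥-elim (covering-colours-impossible
      (m⊔n≤o⇒m≤o 4 (2 * k ∸ 1) bounds) (m⊔n≤o⇒n≤o 4 (2 * k ∸ 1) bounds) φ uses
      (λ v → proj₁ (covering v)) (λ v → proj₂ (covering v)))
  where
  covering : ∀ v → ∃ (Covers φ v)
  covering v = ¬usesExactlyAvoiding⇒covers φ λ uses-v → ¬good (v , uses-v)
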